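{- Suppose $\hat\sigma_0$ has maximum error $\eta$. Let $u,v\in V$ be such that $C_{u,v}(\hat\sigma_0)$ is defined. Then for every $t\in\{0,\dots,m\}$, $$C_{u,v}(\hat\sigma_t)\in[C_{u,v}(\hat\sigma_0)-2\eta,\;C_{u,v}(\hat\sigma_0)+2\eta].$$
   Context: $V$ is a finite vertex set. $\sigma=e_1,\dots,e_m$ is a sequence of $m$ distinct directed edges on $V$. A prediction $\hat\sigma$ is a permutation of $\sigma$. For an edge $e$, $i(e)$ is its position in $\sigma$ and $\hat i(e)$ its position in $\hat\sigma$. The maximum error is $\eta=\max_e|i(e)-\hat i(e)|$. Updated predictions are defined as follows. $\hat\sigma_0=\hat\sigma$. For $t=1,\dots,m$, $e_t$ sits at a position $\hat t\ge t$ in $\hat\sigma_{t-1}$, since $\hat\sigma_{t-1}$ agrees with $\sigma$ on its first $t-1$ positions. The sequence $\hat\sigma_t$ is obtained by moving $e_t$ from position $\hat t$ to position $t$. Edges at positions $t,\dots,\hat t-1$ shift one position later; others are unchanged. For a sequence $\tau$ of these edges and $u,v\in V$, the combining time $C_{u,v}(\tau)$ is the smallest $s\in\{0,\dots,m\}$ such that $u$ and $v$ lie in the same strongly connected component of the graph on $V$ consisting of the first $s$ edges of $\tau$. It is undefined if no such $s$ exists. -}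

module Defs where

open import Data.Nat using (ℕ; zero; suc; _≤_; _<_; _⊔_; ∣_-_∣)
open import Data.Fin using (Fin)
open import Data.Fin.Properties using () renaming (_≟_ to _≟ᶠ_)
open import Data.Product using (_×_; _,_)
open import Data.Product.Properties using (≡-dec)
open import Data.List using (List; []; _∷_; _++_; take; drop; foldr; map; length)
open import Data.List.Membership.Propositional using (_∈_)
open import Data.Maybe using (Maybe; just; nothing)
open import Relation.Nullary using (¬_; Dec; yes; no)
open import Relation.Binary.PropositionalEquality using (_≡_)

-- Vertex set V = Fin n; a directed edge is an ordered pair (tail , head).
Edge : ℕ → Set
Edge n = Fin n × Fin n

_≟ₑ_ : ∀ {n} (e f : Edge n) → Dec (e ≡ f)
_≟ₑ_ = ≡-dec _≟ᶠ_ _≟ᶠ_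

-- 0-indexed position of e in a list (length of the list if absent).
pos : ∀ {n} → Edge n → List (Edge n) → ℕ
pos e [] = zero
pos e (f ∷ l) with e ≟ₑ f
... | yes _ = zero
... | no  _ = suc (pos e l)

nth : ∀ {A : Set} → List A → ℕ → Maybe A
nth [] k = nothing
nth (x ∷ l) zero = just x
nth (x ∷ l) (suc k) = nth l k

maxError : ∀ {n} → List (Edge n) → List (Edge n) → ℕ
maxError σ σ̂ = foldr _⊔_ 0 (map (λ e → ∣ pos e σ - pos e σ̂ ∣) σ)

-- Move the element at position a to position b (b ≤ a): remove it, reinsert at b;
-- elements at positions b, …, a-1 shift one position later.
removeAtℕ : ∀ {A : Set} → List A → ℕ → List A
removeAtℕ l a = take a l ++ drop (suc a) l

insertAtℕ : ∀ {A : Set} → List A → ℕ → A → List A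
insertAtℕ l b x = take b l ++ (x ∷ drop b l)

-- One update step: edge e = e_{t+1} (0-indexed position t in σ) is moved from its
-- current position in the prediction to position t.
moveTo : ∀ {n} → Edge n → ℕ → List (Edge n) → List (Edge n)
moveTo e t l = insertAtℕ (removeAtℕ l (pos e l)) t e

updated : ∀ {n} → List (Edge n) → List (Edge n) → ℕ → List (Edge n)
updated σ σ̂ zero = σ̂
updated σ σ̂ (suc t) with nth σ t
... | just e  = moveTo e t (updated σ σ̂ t)
... | nothing = updated σ σ̂ t

data Reach {n} (E : List (Edge n)) : Fin n → Fin n → Set where
  here : ∀ {x} → Reach E x x
  step : ∀ {x y z} → (x , y) ∈ E → Reach E y z → Reach E x z

SameSCC : ∀ {n} → List (Edge n) → Fin n → Fin n → Set
SameSCC E u v = Reach E u v × Reach E v u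

IsCombTime : ∀ {n} → List (Edge n) → Fin n → Fin n → ℕ → Set
IsCombTime τ u v s =
  s ≤ length τ × SameSCC (take s τ) u v × (∀ s' → s' < s → ¬ SameSCC (take s' τ) u v)

{-# OPTIONS --safe #-}
-- After t updates the prediction lists e₁, …, e_t at their true positions, followed by the
-- remaining edges in their predicted relative order. A placed edge is thus within η of its
-- predicted position. A pending edge f never moves left, and it is pushed one step right
-- only when the edge e being placed was predicted after it; then
-- i(f) ≤ î(f) + η < î(e) + η ≤ i(e) + 2η, so this happens only during the 2η steps before
-- f's own turn. Hence every edge stays within 2η of its predicted position, which puts
-- the first c edges of either sequence among the first c + 2η of the other and so moves
-- combining times by at most 2η.
module Submission where

open import Defs
open import Data.Nat
  using (ℕ; zero; suc; _≤_; _<_; _+_; _*_; _∸_; _⊔_; ∣_-_∣; z≤n; s≤s; s≤s⁻¹; _<?_)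
open import Data.Nat.Properties
open import Data.Nat.Induction using (<-rec)
open import Data.Fin using (Fin)
open import Data.Fin.Properties using () renaming (_≟_ to _≟ᶠ_)
open import Data.Product using (_×_; _,_; proj₁; proj₂; ∃)
open import Data.Sum using (_⊎_; inj₁; inj₂; [_,_])
open import Data.Maybe using (just)
open import Function using (id)
open import Data.List using (List; []; _∷_; _++_; length; take; drop; foldr)
open import Data.List.Properties using (take++drop≡id; take-all)
open import Data.List.Membership.Propositional using (_∈_)
open import Data.List.Membership.Propositional.Properties using (∈-map⁺)
open import Data.List.Relation.Unary.Any as Any using (here; there)
import Data.List.Relation.Unary.All as All
open import Data.List.Relation.Unary.AllPairs using (_∷_)
open import Data.List.Relation.Unary.Unique.Propositional using (Unique)
open import Data.List.Relation.Binary.Subset.Propositional using (_⊆_)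
import Data.List.Relation.Binary.Sublist.Propositional.Properties as Sublist
open import Data.List.Relation.Binary.Permutation.Propositional using (_↭_; ↭-sym; ↭-trans)
open import Data.List.Relation.Binary.Permutation.Propositional.Properties using (shift; ∈-resp-↭)
open import Relation.Nullary using (¬_; Dec; yes; no; contradiction)
open import Relation.Nullary.Decidable using (_×-dec_)
open import Relation.Binary.Definitions using (tri<; tri≈; tri>)
open import Relation.Binary.PropositionalEquality
  using (_≡_; _≢_; refl; sym; trans; cong; subst)

private
  variable
    n a b t : ℕ
    e f x : Edge n
    l : List (Edge n)

pos-injective : e ∈ l → pos f l ≡ pos e l → f ≡ e
pos-injective {e = e} {l = x ∷ l} {f = f} e∈ eq with f ≟ₑ x | e ≟ₑ x
... | yes f≡x | yes e≡x = trans f≡x (sym e≡x)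
... | yes _   | no _    = contradiction eq 0≢1+n
... | no _    | yes _   = contradiction eq 1+n≢0
... | no _    | no e≢x  = pos-injective (Any.tail e≢x e∈) (suc-injective eq)

∈-take⇒pos< : ∀ k → x ∈ take k l → pos x l < k
∈-take⇒pos< {l = []}    (suc k) ()
∈-take⇒pos< {x = x} {l = y ∷ l} (suc k) x∈ with x ≟ₑ y
... | yes _   = s≤s z≤n
... | no x≢y  = s≤s (∈-take⇒pos< k (Any.tail x≢y x∈))

pos<⇒∈-take : ∀ k → x ∈ l → pos x l < k → x ∈ take k l
pos<⇒∈-take {x = x} {l = y ∷ l} (suc k) x∈ lt with x ≟ₑ y
... | yes x≡y = here x≡y
... | no x≢y  = there (pos<⇒∈-take k (Any.tail x≢y x∈) (s≤s⁻¹ lt))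

drop-pos : e ∈ l → drop (pos e l) l ≡ e ∷ drop (suc (pos e l)) l
drop-pos {e = e} {l = x ∷ l} e∈ with e ≟ₑ x
... | yes e≡x = cong (_∷ l) (sym e≡x)
... | no e≢x  = drop-pos (Any.tail e≢x e∈)

↭-removeAtℕ-pos : e ∈ l → l ↭ e ∷ removeAtℕ l (pos e l)
↭-removeAtℕ-pos {e = e} {l = l} e∈ =
  subst (_↭ e ∷ removeAtℕ l p)
    (trans (cong (take p l ++_) (sym (drop-pos e∈))) (take++drop≡id p l))
    (shift e (take p l) (drop (suc p) l))
  where p = pos e l

insertAtℕ-↭ : ∀ (l : List (Edge n)) b e → insertAtℕ l b e ↭ e ∷ l
insertAtℕ-↭ l b e =
  subst (λ l′ → insertAtℕ l b e ↭ e ∷ l′) (take++drop≡id b l) (shift e (take b l) (drop b l))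

∈-removeAtℕ-pos : e ∈ l → f ∈ l → f ≢ e → f ∈ removeAtℕ l (pos e l)
∈-removeAtℕ-pos e∈ f∈ f≢e = Any.tail f≢e (∈-resp-↭ (↭-removeAtℕ-pos e∈) f∈)

pos-removeAtℕ-< : pos f l < a → pos f (removeAtℕ l a) ≡ pos f l
pos-removeAtℕ-< {l = []}    {a = suc a} _ = refl
pos-removeAtℕ-< {f = f} {l = x ∷ l} {a = suc a} lt with f ≟ₑ x
... | yes _ = refl
... | no _  = cong suc (pos-removeAtℕ-< (s≤s⁻¹ lt))

pos-removeAtℕ-> : a < pos f l → pos f l ≡ suc (pos f (removeAtℕ l a))
pos-removeAtℕ-> {a = zero} {f = f} {l = x ∷ l} gt with f ≟ₑ x
... | no _ = refl
pos-removeAtℕ-> {a = suc a} {f = f} {l = x ∷ l} gt with f ≟ₑ x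
... | no _ = cong suc (pos-removeAtℕ-> (s≤s⁻¹ gt))

pos-removeAtℕ-≥ : a ≤ pos f l → a ≤ pos f (removeAtℕ l a)
pos-removeAtℕ-≥ {a = zero} _ = z≤n
pos-removeAtℕ-≥ {a = suc a} {f = f} {l = x ∷ l} ge with f ≟ₑ x
... | no _ = s≤s (pos-removeAtℕ-≥ (s≤s⁻¹ ge))

pos-insertAtℕ-< : f ∈ l → pos f l < b → pos f (insertAtℕ l b e) ≡ pos f l
pos-insertAtℕ-< {f = f} {l = x ∷ l} {b = suc b} f∈ lt with f ≟ₑ x
... | yes _  = refl
... | no f≢x = cong suc (pos-insertAtℕ-< (Any.tail f≢x f∈) (s≤s⁻¹ lt))

pos-insertAtℕ-≥ : f ≢ e → b ≤ pos f l → pos f (insertAtℕ l b e) ≡ suc (pos f l)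
pos-insertAtℕ-≥ {f = f} {e = e} {b = zero} f≢e _ with f ≟ₑ e
... | yes f≡e = contradiction f≡e f≢e
... | no _    = refl
pos-insertAtℕ-≥ {f = f} {b = suc b} {l = x ∷ l} f≢e ge with f ≟ₑ x
... | no _ = cong suc (pos-insertAtℕ-≥ f≢e (s≤s⁻¹ ge))

pos-insertAtℕ-self : b ≤ pos e l → pos e (insertAtℕ l b e) ≡ b
pos-insertAtℕ-self {b = zero} {e = e} _ with e ≟ₑ e
... | yes _   = refl
... | no e≢e  = contradiction refl e≢e
pos-insertAtℕ-self {b = suc b} {e = e} {l = x ∷ l} ge with e ≟ₑ x
... | no _ = cong suc (pos-insertAtℕ-self (s≤s⁻¹ ge))

nth-<length : ∀ {A : Set} j (l : List A) → j < length l → ∃ λ x → nth l j ≡ just x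
nth-<length zero    (x ∷ l) _  = x , refl
nth-<length (suc j) (x ∷ l) lt = nth-<length j l (s≤s⁻¹ lt)

nth-just⇒∈ : ∀ {A : Set} {x : A} l j → nth l j ≡ just x → x ∈ l
nth-just⇒∈ (y ∷ l) zero    refl = here refl
nth-just⇒∈ (y ∷ l) (suc j) eq   = there (nth-just⇒∈ l j eq)

nth-just⇒pos : ∀ l j → Unique l → nth l j ≡ just e → pos e l ≡ j
nth-just⇒pos {e = e} (x ∷ l) zero _ refl with e ≟ₑ e
... | yes _  = refl
... | no e≢e = contradiction refl e≢e
nth-just⇒pos {e = e} (x ∷ l) (suc j) (x∉l ∷ l-unique) eq with e ≟ₑ x
... | yes refl = contradiction refl (All.lookup x∉l (nth-just⇒∈ l j eq))
... | no _     = cong suc (nth-just⇒pos l j l-unique eq)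

moveTo-↭ : e ∈ l → moveTo e t l ↭ l
moveTo-↭ {e = e} {l = l} {t = t} e∈ =
  ↭-trans (insertAtℕ-↭ (removeAtℕ l (pos e l)) t e) (↭-sym (↭-removeAtℕ-pos e∈))

pos-moveTo-self : t ≤ pos e l → pos e (moveTo e t l) ≡ t
pos-moveTo-self t≤p = pos-insertAtℕ-self (≤-trans t≤p (pos-removeAtℕ-≥ ≤-refl))

pos-moveTo-< : e ∈ l → f ∈ l → pos f l < t → t ≤ pos e l → pos f (moveTo e t l) ≡ pos f l
pos-moveTo-< {e = e} {l = l} {f = f} e∈ f∈ f<t t≤p =
  trans (pos-insertAtℕ-< (∈-removeAtℕ-pos e∈ f∈ f≢e) (subst (_< _) (sym unmoved) f<t)) unmoved
  where
  f<p : pos f l < pos e l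
  f<p = <-≤-trans f<t t≤p
  f≢e : f ≢ e
  f≢e refl = <-irrefl refl f<p
  unmoved : pos f (removeAtℕ l (pos e l)) ≡ pos f l
  unmoved = pos-removeAtℕ-< f<p

data Shifted (p a a′ : ℕ) : Set where
  below : a < p → a′ ≡ suc a → Shifted p a a′
  above : p < a → a′ ≡ a     → Shifted p a a′

Shifted-≤ : ∀ {p a a′} → Shifted p a a′ → a ≤ a′
Shifted-≤ (below _ refl) = n≤1+n _
Shifted-≤ (above _ refl) = ≤-refl

Shifted-reflects-< : ∀ {p a a′ b b′} → Shifted p a a′ → Shifted p b b′ → a′ < b′ → a < b
Shifted-reflects-< (below _ refl)   (below _ refl)   lt = s≤s⁻¹ lt
Shifted-reflects-< (below a<p refl) (above p<b refl) _  = <-trans a<p p<b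
Shifted-reflects-< (above p<a refl) (below b<p refl) lt =
  contradiction (<-trans p<a (≤-<-trans (s≤s⁻¹ lt) b<p)) (<-irrefl refl)
Shifted-reflects-< (above _ refl)   (above _ refl)   lt = lt

pos-moveTo-Shifted : e ∈ l → f ≢ e → t ≤ pos f l → t ≤ pos e l →
                     Shifted (pos e l) (pos f l) (pos f (moveTo e t l))
pos-moveTo-Shifted {e = e} {l = l} {f = f} {t = t} e∈ f≢e t≤f t≤p with <-cmp (pos f l) (pos e l)
... | tri< f<p _ _ = below f<p shifted
  where
  unmoved : pos f (removeAtℕ l (pos e l)) ≡ pos f l
  unmoved = pos-removeAtℕ-< f<p
  shifted : pos f (moveTo e t l) ≡ suc (pos f l)
  shifted = trans (pos-insertAtℕ-≥ f≢e (subst (t ≤_) (sym unmoved) t≤f)) (cong suc unmoved)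
... | tri≈ _ f≡p _ = contradiction (pos-injective e∈ f≡p) f≢e
... | tri> _ _ p<f = above p<f restored
  where
  removed : pos f l ≡ suc (pos f (removeAtℕ l (pos e l)))
  removed = pos-removeAtℕ-> p<f
  restored : pos f (moveTo e t l) ≡ pos f l
  restored = trans (pos-insertAtℕ-≥ f≢e (≤-trans t≤p (s≤s⁻¹ (subst (pos e l <_) removed p<f))))
                   (sym removed)

Reach-mono : ∀ {E E′ : List (Edge n)} {y z} → E ⊆ E′ → Reach E y z → Reach E′ y z
Reach-mono E⊆E′ here         = here
Reach-mono E⊆E′ (step xy∈ r) = step (E⊆E′ xy∈) (Reach-mono E⊆E′ r)

Reach-trans : ∀ {E : List (Edge n)} {x y z} → Reach E x y → Reach E y z → Reach E x z
Reach-trans here         r′ = r′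
Reach-trans (step xy∈ r) r′ = step xy∈ (Reach-trans r r′)

Reach-∷⁻ : ∀ {E : List (Edge n)} {a b x z} → Reach ((a , b) ∷ E) x z →
           Reach E x z ⊎ (Reach E x a × Reach E b z)
Reach-∷⁻ here = inj₁ here
Reach-∷⁻ (step (here refl) r) = inj₂ (here , [ id , proj₂ ] (Reach-∷⁻ r))
Reach-∷⁻ (step (there xy∈) r) with Reach-∷⁻ r
... | inj₁ r′         = inj₁ (step xy∈ r′)
... | inj₂ (r₁ , r₂)  = inj₂ (step xy∈ r₁ , r₂)

Reach? : ∀ (E : List (Edge n)) x z → Dec (Reach E x z)
Reach? [] x z with x ≟ᶠ z
... | yes refl = yes here
... | no x≢z   = no λ { here → x≢z refl ; (step () _) }
Reach? ((a , b) ∷ E) x z with Reach? E x z | Reach? E x a | Reach? E b z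
... | yes r | _ | _ = yes (Reach-mono there r)
... | no _ | yes r₁ | yes r₂ =
  yes (Reach-trans (Reach-mono there r₁) (step (here refl) (Reach-mono there r₂)))
... | no ¬r | no ¬r₁ | _ = no λ r → [ ¬r , (λ rs → ¬r₁ (proj₁ rs)) ] (Reach-∷⁻ r)
... | no ¬r | yes _ | no ¬r₂ = no λ r → [ ¬r , (λ rs → ¬r₂ (proj₂ rs)) ] (Reach-∷⁻ r)

SameSCC? : ∀ (E : List (Edge n)) u v → Dec (SameSCC E u v)
SameSCC? E u v = Reach? E u v ×-dec Reach? E v u

SameSCC-mono : ∀ {E E′ : List (Edge n)} {u v} → E ⊆ E′ → SameSCC E u v → SameSCC E′ u v
SameSCC-mono E⊆E′ (ruv , rvu) = Reach-mono E⊆E′ ruv , Reach-mono E⊆E′ rvu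

Minimal : (ℕ → Set) → ℕ → Set
Minimal P s = P s × (∀ s′ → s′ < s → ¬ P s′)

minimal-witness : ∀ {P : ℕ → Set} → (∀ s → Dec (P s)) →
                  ∀ c → P c → ∃ λ s → s ≤ c × Minimal P s
minimal-witness {P} P? = <-rec (λ c → P c → ∃ λ s → s ≤ c × Minimal P s) search
  where
  search : ∀ c → (∀ {c′} → c′ < c → P c′ → ∃ λ s → s ≤ c′ × Minimal P s) →
           P c → ∃ λ s → s ≤ c × Minimal P s
  search c rec pc with anyUpTo? P? c
  ... | yes (c′ , c′<c , pc′) with rec c′<c pc′
  ...   | s , s≤c′ , min = s , ≤-trans s≤c′ (<⇒≤ c′<c) , min
  search c rec pc | no none = c , ≤-refl , pc , λ s′ s′<c ps′ → none (s′ , s′<c , ps′)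

combTime-exists : ∀ (τ : List (Edge n)) {u v c} → SameSCC (take c τ) u v →
                  ∃ λ s → IsCombTime τ u v s × s ≤ c
combTime-exists τ {u} {v} {c} scc with minimal-witness (λ s → SameSCC? (take s τ) u v) c scc
... | s , s≤c , scc-s , earlier = s , (s≤length , scc-s , earlier) , s≤c
  where
  s≤length : s ≤ length τ
  s≤length = ≮⇒≥ λ length<s →
    earlier (length τ) length<s
      (subst (λ τ′ → SameSCC τ′ u v)
             (trans (take-all s τ (<⇒≤ length<s)) (sym (take-all (length τ) τ ≤-refl)))
             scc-s)

combTime-minimal : ∀ {τ : List (Edge n)} {u v c s} →
                   IsCombTime τ u v c → SameSCC (take s τ) u v → c ≤ s
combTime-minimal (_ , _ , earlier) scc = ≮⇒≥ λ s<c → earlier _ s<c scc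

take-⊆-take : ∀ {τ τ′ : List (Edge n)} d → τ ⊆ τ′ →
              (∀ {f} → f ∈ τ → pos f τ′ ≤ pos f τ + d) → ∀ c → take c τ ⊆ take (c + d) τ′
take-⊆-take {τ = τ} {τ′} d τ⊆τ′ displaced c {f} f∈ =
  pos<⇒∈-take (c + d) (τ⊆τ′ f∈τ)
    (≤-<-trans (displaced f∈τ) (+-monoˡ-< d (∈-take⇒pos< c f∈)))
  where
  f∈τ : f ∈ τ
  f∈τ = Sublist.Any-resp-⊆ (Sublist.take-⊆ c τ) f∈

combTime-stable : ∀ {τ τ′ : List (Edge n)} {u v c} d → τ ↭ τ′ →
                  (∀ {f} → f ∈ τ → pos f τ′ ≤ pos f τ + d) →
                  (∀ {f} → f ∈ τ → pos f τ ≤ pos f τ′ + d) →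
                  IsCombTime τ u v c →
                  ∃ λ c′ → IsCombTime τ′ u v c′ × c ≤ c′ + d × c′ ≤ c + d
combTime-stable {τ = τ} {τ′} {c = c} d τ↭τ′ later earlier c-comb@(_ , scc , _)
  with combTime-exists τ′ (SameSCC-mono (take-⊆-take d (∈-resp-↭ τ↭τ′) later c) scc)
... | c′ , c′-comb@(_ , scc′ , _) , c′≤c+d = c′ , c′-comb , c≤c′+d , c′≤c+d
  where
  τ′⊆τ : τ′ ⊆ τ
  τ′⊆τ = ∈-resp-↭ (↭-sym τ↭τ′)
  c≤c′+d : c ≤ c′ + d
  c≤c′+d = combTime-minimal c-comb
    (SameSCC-mono (take-⊆-take d τ′⊆τ (λ f∈ → earlier (τ′⊆τ f∈)) c′) scc′)

module Updates {n} (σ σ̂ : List (Edge n)) (σ-unique : Unique σ) (σ̂↭σ : σ̂ ↭ σ)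
               (η : ℕ) (error≤η : ∀ {f} → f ∈ σ → ∣ pos f σ - pos f σ̂ ∣ ≤ η) where

  i î : Edge n → ℕ
  i f = pos f σ
  î f = pos f σ̂

  i≤î+η : ∀ {f} → f ∈ σ → i f ≤ î f + η
  i≤î+η {f} f∈ = ≤-trans (m≤n+∣m-n∣ (i f) (î f)) (+-monoʳ-≤ (î f) (error≤η f∈))

  î≤i+η : ∀ {f} → f ∈ σ → î f ≤ i f + η
  î≤i+η {f} f∈ = ≤-trans (m≤n+∣n-m∣ (î f) (i f)) (+-monoʳ-≤ (i f) (error≤η f∈))

  η≤2η : η ≤ 2 * η
  η≤2η = m≤m+n η (η + 0)

  predicted-before⇒i<i+2η : ∀ {e f} → e ∈ σ → f ∈ σ → î f < î e → i f < i e + 2 * η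
  predicted-before⇒i<i+2η {e} {f} e∈ f∈ î<î = begin-strict
    i f            ≤⟨ i≤î+η f∈ ⟩
    î f + η        <⟨ +-monoˡ-< η î<î ⟩
    î e + η        ≤⟨ +-monoˡ-≤ η (î≤i+η e∈) ⟩
    i e + η + η    ≡⟨ +-assoc (i e) η η ⟩
    i e + (η + η)  ≡⟨ cong (λ k → i e + (η + k)) (sym (+-identityʳ η)) ⟩
    i e + 2 * η    ∎
    where open ≤-Reasoning

  record Invariant (t : ℕ) (L : List (Edge n)) : Set where
    field
      L↭σ             : L ↭ σ
      settled         : ∀ {f} → f ∈ σ → i f < t → pos f L ≡ i f
      pending-≥t      : ∀ {f} → f ∈ σ → t ≤ i f → t ≤ pos f L
      pending-≥î      : ∀ {f} → f ∈ σ → t ≤ i f → î f ≤ pos f L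
      -- the slack counts the steps so far at which f could have been pushed right
      pending-≤       : ∀ {f} → f ∈ σ → t ≤ i f → pos f L ≤ î f + (t + 2 * η ∸ suc (i f))
      pending-ordered : ∀ {f g} → f ∈ σ → g ∈ σ → t ≤ i f → t ≤ i g →
                        pos f L < pos g L → î f < î g

  invariant-zero : Invariant 0 σ̂
  invariant-zero = record
    { L↭σ             = σ̂↭σ
    ; settled         = λ _ ()
    ; pending-≥t      = λ _ _ → z≤n
    ; pending-≥î      = λ _ _ → ≤-refl
    ; pending-≤       = λ {f} _ _ → m≤m+n (î f) _
    ; pending-ordered = λ _ _ _ _ lt → lt
    }

  module Step {t L e} (I : Invariant t L) (e-at-t : nth σ t ≡ just e) where
    open Invariant I

    e∈σ : e ∈ σ
    e∈σ = nth-just⇒∈ σ t e-at-t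

    i[e]≡t : i e ≡ t
    i[e]≡t = nth-just⇒pos σ t σ-unique e-at-t

    ∈L : ∀ {f} → f ∈ σ → f ∈ L
    ∈L = ∈-resp-↭ (↭-sym L↭σ)

    t≤pos[e] : t ≤ pos e L
    t≤pos[e] = pending-≥t e∈σ (≤-reflexive (sym i[e]≡t))

    L′ : List (Edge n)
    L′ = moveTo e t L

    settled′ : ∀ {f} → f ∈ σ → i f < suc t → pos f L′ ≡ i f
    settled′ {f} f∈ i<1+t with m≤n⇒m<n∨m≡n (s≤s⁻¹ i<1+t)
    ... | inj₁ i<t =
      trans (pos-moveTo-< (∈L e∈σ) (∈L f∈) (subst (_< t) (sym (settled f∈ i<t)) i<t) t≤pos[e])
            (settled f∈ i<t)
    ... | inj₂ i≡t with pos-injective e∈σ (trans i≡t (sym i[e]≡t))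
    ...   | refl = trans (pos-moveTo-self {l = L} t≤pos[e]) (sym i≡t)

    pending-Shifted : ∀ {f} → f ∈ σ → suc t ≤ i f → Shifted (pos e L) (pos f L) (pos f L′)
    pending-Shifted {f} f∈ t<i =
      pos-moveTo-Shifted (∈L e∈σ) f≢e (pending-≥t f∈ (<⇒≤ t<i)) t≤pos[e]
      where
      f≢e : f ≢ e
      f≢e refl = <-irrefl (sym i[e]≡t) t<i

    pending-≥t′ : ∀ {f} → f ∈ σ → suc t ≤ i f → suc t ≤ pos f L′
    pending-≥t′ f∈ t<i with pending-Shifted f∈ t<i
    ... | below _ eq   = subst (suc t ≤_) (sym eq) (s≤s (pending-≥t f∈ (<⇒≤ t<i)))
    ... | above p<f eq = subst (suc t ≤_) (sym eq) (≤-<-trans t≤pos[e] p<f)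

    pending-≥î′ : ∀ {f} → f ∈ σ → suc t ≤ i f → î f ≤ pos f L′
    pending-≥î′ f∈ t<i = ≤-trans (pending-≥î f∈ (<⇒≤ t<i)) (Shifted-≤ (pending-Shifted f∈ t<i))

    pending-≤′ : ∀ {f} → f ∈ σ → suc t ≤ i f → pos f L′ ≤ î f + (suc t + 2 * η ∸ suc (i f))
    pending-≤′ {f} f∈ t<i with pending-Shifted f∈ t<i
    ... | above _ eq = subst (_≤ _) (sym eq)
          (≤-trans (pending-≤ f∈ (<⇒≤ t<i))
                   (+-monoʳ-≤ (î f) (∸-monoˡ-≤ (suc (i f)) (n≤1+n _))))
    ... | below f<p eq = subst (_≤ _) (sym eq) (begin
          suc (pos f L)                           ≤⟨ s≤s (pending-≤ f∈ (<⇒≤ t<i)) ⟩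
          suc (î f + (t + 2 * η ∸ suc (i f)))     ≡⟨ sym (+-suc (î f) _) ⟩
          î f + suc (t + 2 * η ∸ suc (i f))       ≡⟨ cong (î f +_) (sym (+-∸-assoc 1 i<t+2η)) ⟩
          î f + (suc t + 2 * η ∸ suc (i f))       ∎)
      where
      open ≤-Reasoning
      i<t+2η : i f < t + 2 * η
      i<t+2η = subst (λ k → i f < k + 2 * η) i[e]≡t
        (predicted-before⇒i<i+2η e∈σ f∈
          (pending-ordered f∈ e∈σ (<⇒≤ t<i) (≤-reflexive (sym i[e]≡t)) f<p))

    pending-ordered′ : ∀ {f g} → f ∈ σ → g ∈ σ → suc t ≤ i f → suc t ≤ i g →
                       pos f L′ < pos g L′ → î f < î g
    pending-ordered′ f∈ g∈ t<i[f] t<i[g] lt =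
      pending-ordered f∈ g∈ (<⇒≤ t<i[f]) (<⇒≤ t<i[g])
        (Shifted-reflects-< (pending-Shifted f∈ t<i[f]) (pending-Shifted g∈ t<i[g]) lt)

    invariant′ : Invariant (suc t) L′
    invariant′ = record
      { L↭σ             = ↭-trans (moveTo-↭ (∈L e∈σ)) L↭σ
      ; settled         = settled′
      ; pending-≥t      = pending-≥t′
      ; pending-≥î      = pending-≥î′
      ; pending-≤       = pending-≤′
      ; pending-ordered = pending-ordered′
      }

  updated-suc : ∀ {t e} → nth σ t ≡ just e → updated σ σ̂ (suc t) ≡ moveTo e t (updated σ σ̂ t)
  updated-suc e-at-t rewrite e-at-t = refl

  invariant : ∀ t → t ≤ length σ → Invariant t (updated σ σ̂ t)
  invariant zero    _  = invariant-zero
  invariant (suc t) lt with nth-<length t σ lt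
  ... | e , e-at-t = subst (Invariant (suc t)) (sym (updated-suc e-at-t))
                           (Step.invariant′ (invariant t (<⇒≤ lt)) e-at-t)

  displacement-≤ : ∀ {t L f} → Invariant t L → f ∈ σ → pos f L ≤ î f + 2 * η
  displacement-≤ {t} {L} {f} I f∈ with i f <? t
  ... | yes i<t = subst (_≤ î f + 2 * η) (sym (Invariant.settled I f∈ i<t))
                        (≤-trans (i≤î+η f∈) (+-monoʳ-≤ (î f) η≤2η))
  ... | no i≮t = ≤-trans (Invariant.pending-≤ I f∈ t≤i) (+-monoʳ-≤ (î f) slack≤2η)
    where
    t≤i : t ≤ i f
    t≤i = ≮⇒≥ i≮t
    slack≤2η : t + 2 * η ∸ suc (i f) ≤ 2 * η
    slack≤2η = m≤n+o⇒m∸n≤o (t + 2 * η) (suc (i f)) (+-monoˡ-≤ (2 * η) (m≤n⇒m≤1+n t≤i))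

  displacement-≥ : ∀ {t L f} → Invariant t L → f ∈ σ → î f ≤ pos f L + 2 * η
  displacement-≥ {t} {L} {f} I f∈ with i f <? t
  ... | yes i<t = subst (λ k → î f ≤ k + 2 * η) (sym (Invariant.settled I f∈ i<t))
                        (≤-trans (î≤i+η f∈) (+-monoʳ-≤ (i f) η≤2η))
  ... | no i≮t = ≤-trans (Invariant.pending-≥î I f∈ (≮⇒≥ i≮t)) (m≤m+n (pos f L) (2 * η))

≤-foldr-⊔ : ∀ {m} {ms : List ℕ} → m ∈ ms → m ≤ foldr _⊔_ 0 ms
≤-foldr-⊔ (here refl)           = m≤m⊔n _ _
≤-foldr-⊔ {ms = m′ ∷ _} (there m∈) = ≤-trans (≤-foldr-⊔ m∈) (m≤n⊔m m′ _)

error≤maxError : ∀ (σ σ̂ : List (Edge n)) → f ∈ σ → ∣ pos f σ - pos f σ̂ ∣ ≤ maxError σ σ̂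
error≤maxError σ σ̂ f∈ = ≤-foldr-⊔ (∈-map⁺ (λ e → ∣ pos e σ - pos e σ̂ ∣) f∈)

lemma5 : ∀ {n : ℕ} (σ σ̂ : List (Edge n)) → Unique σ → σ̂ ↭ σ →
           ∀ (η : ℕ) → η ≡ maxError σ σ̂ →
           ∀ (u v : Fin n) (c₀ : ℕ) → IsCombTime σ̂ u v c₀ →
           ∀ (t : ℕ) → t ≤ length σ →
           ∃ λ c → IsCombTime (updated σ σ̂ t) u v c × (c₀ ≤ c + 2 * η) × (c ≤ c₀ + 2 * η)
lemma5 σ σ̂ σ-unique σ̂↭σ η refl u v c₀ c₀-comb t t≤m =
  combTime-stable (2 * η) (↭-trans σ̂↭σ (↭-sym (Invariant.L↭σ I)))
    (λ f∈ → displacement-≤ I (∈σ f∈)) (λ f∈ → displacement-≥ I (∈σ f∈)) c₀-comb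
  where
  open Updates σ σ̂ σ-unique σ̂↭σ η (error≤maxError σ σ̂)
  I : Invariant t (updated σ σ̂ t)
  I = invariant t t≤m
  ∈σ : ∀ {f} → f ∈ σ̂ → f ∈ σ
  ∈σ = ∈-resp-↭ σ̂↭σ
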